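{- Consider the algorithm RBIS described in the context, run with any responses in which at most $H$ are incorrect. Then (i) the node $a_u$ is at depth at least $\lfloor n/2\rfloor-2H$ in $T$ (the root having depth $0$); and (ii) the leaf $L_x$ is a leaf of the subtree of $T$ rooted at $a_u$.
   Context: Setting: $0<m<M$ and an integer $n\ge1$. Let $\rho=(M/m)^{1/2^n}$, $a_i=m\rho^i$ for $i=0,\dots,2^n$, and $L_i=(a_{i-1},a_i]$ for $i=1,\dots,2^n$. There is an unknown best price $p^*\in[m,M]$; let $x$ be the index with $p^*\in L_x$ (with $x=1$ if $p^*=m$). Let $T$ be a complete binary tree of height $n$ whose leaves from left to right are $L_1,\dots,L_{2^n}$; for an internal node $v$, $l(v),r(v)$ are its children and $q_v$ is the index of the rightmost leaf of the subtree rooted at $l(v)$. The main query of $v$ is "Is $p^*\le a_{q_v}$?" (equivalently "is $x\le q_v$?"). Queries are answered adaptively by an oracle; the answer to a query is correct if it is the true answer, and over the whole run at most $H$ answers are incorrect. Algorithm RBIS (Robust Binary Interval Search) uses $n$ queries in total. It starts with the current node $v$ equal to the root and a counter $mu=0$, and repeats the following iteration: ask the main query of $v$ and store the answer as $\mathtt{main}(v)$ (overwriting any earlier stored answer for $v$); let $anc(v)$ be the nearest proper ancestor $w$ of $v$ whose currently stored $\mathtt{main}(w)$ differs from $\mathtt{main}(v)$, or none if no such ancestor exists; if $anc(v)$ exists, ask again the main query of $w=anc(v)$ (the checkup query) and call its answer $\mathtt{check}(v)$. Then: if $anc(v)$ does not exist or $\mathtt{check}(v)=\mathtt{main}(anc(v))$,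 perform a Move-down: move to $l(v)$ if $\mathtt{main}(v)$ is Yes and to $r(v)$ if it is No; otherwise perform a Move-up: move to the parent of $v$ and increase $mu$ by one. The search stops as soon as $n$ queries have been asked (an iteration that cannot ask its needed queries performs no move). Let $u$ be the final node and $mu_{end}$ the final value of $mu$; let $a_u$ be the $(H-mu_{end})$-th ancestor of $u$ (or the root if it does not exist), and let $L_l$ be the leftmost leaf of the subtree rooted at $a_u$. RBIS then uses reservation price $a_{l-1}$, i.e. accepts the first revealed price that is at least $a_{l-1}$ (the last price by default). -}

module Defs where

open import Data.Nat using (ℕ; zero; suc; _+_; _*_; _∸_; _^_; _≤_; _≤ᵇ_)
open import Data.Bool using (Bool; true; false; not; if_then_else_; _≟_)
open import Data.List using (List; []; _∷_; _++_; length; drop)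
open import Data.List.Properties using (≡-dec)
open import Data.Maybe using (Maybe; just; nothing)
open import Data.Product using (_×_; _,_)
open import Relation.Nullary using (does)

-- A node of the complete binary tree T of height n is given by its path from
-- the root, stored REVERSED (head = last step).  false = left child l(v),
-- true = right child r(v).
Node : Set
Node = List Bool

depth : Node → ℕ
depth = length

-- position of the node among the nodes of its depth (0-based, left to right)
offset : Node → ℕ
offset []            = 0
offset (false ∷ p)   = 2 * offset p
offset (true  ∷ p)   = 2 * offset p + 1

-- leaves L_1..L_{2^n} are indexed 1..2^n.
-- leftmost / rightmost leaf index of the subtree rooted at v
leftLeaf : ℕ → Node → ℕ
leftLeaf n v = offset v * 2 ^ (n ∸ depth v) + 1

rightLeaf : ℕ → Node → ℕ
rightLeaf n v = (offset v + 1) * 2 ^ (n ∸ depth v)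

qIdx : ℕ → Node → ℕ
qIdx n v = rightLeaf n (false ∷ v)

InSubtree : ℕ → Node → ℕ → Set
InSubtree n v x = leftLeaf n v ≤ x × x ≤ rightLeaf n v

parent : Node → Node
parent []      = []
parent (_ ∷ p) = p

child : Bool → Node → Node   -- answer Yes (true) -> left, No (false) -> right
child true  v = false ∷ v
child false v = true  ∷ v

-- A query "is x ≤ q ?" is identified by q.  An adaptive oracle answers a query
-- as an arbitrary function of the history and the query.
History : Set
History = List (ℕ × Bool)

Oracle : Set
Oracle = History → ℕ → Bool

wrong : ℕ → History → ℕ
wrong x []              = 0
wrong x ((q , a) ∷ h)   = (if does (a ≟ (x ≤ᵇ q)) then 0 else 1) + wrong x h

Store : Set
Store = Node → Maybe Bool

update : Store → Node → Bool → Store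
update st v a w = if does (≡-dec _≟_ w v) then just a else st w

ancestors : Node → List Node
ancestors []      = []
ancestors (_ ∷ p) = p ∷ ancestors p

findDiff : Store → Bool → List Node → Maybe Node
findDiff st a []       = nothing
findDiff st a (w ∷ ws) with st w
... | just b  = if does (b ≟ a) then findDiff st a ws else just w
... | nothing = findDiff st a ws

record State : Set where
  constructor st
  field
    node  : Node
    store : Store
    mu    : ℕ
    hist  : History
open State public

-- run of RBIS with k queries still available
run : ℕ → Oracle → ℕ → State → State
run n O zero s = s
run n O (suc k) (st v sto m h) =
  let q   = qIdx n v
      a   = O h q
      h1  = h ++ ((q , a) ∷ [])
      st1 = update sto v a
  in step k (findDiff st1 a (ancestors v)) v st1 m h1 a
  where
  step : ℕ → Maybe Node → Node → Store → ℕ → History → Bool → State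
  step k nothing  v sto m h a = run n O k (st (child a v) sto m h)
  step zero (just w) v sto m h a = st v sto m h      -- no checkup possible: no move
  step (suc k) (just w) v sto m h a =
    let qw = qIdx n w
        c  = O h qw
        h2 = h ++ ((qw , c) ∷ [])
    in if does (c ≟ not a)                          -- check(v) = main(anc(v))
       then run n O k (st (child a v) sto m h2)
       else run n O k (st (parent v) sto (suc m) h2)

initial : State
initial = st [] (λ _ → nothing) 0 []

rbis : ℕ → Oracle → State
rbis n O = run n O n initial

-- a_u : the (H - mu_end)-th ancestor of the final node u (root if none)
finalNode : ℕ → ℕ → Oracle → Node
finalNode n H O = drop (H ∸ mu (rbis n O)) (node (rbis n O))

-- Let dist v be the number of levels one has to climb from v to reach a subtree
-- containing L_x.  Each iteration raises the potential mu + dist v by at most the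
-- number of incorrect answers it receives.  A Move-up climbs towards L_x unless v
-- lies on the path to L_x; there the stored answers are the true ones, so the
-- checkup that caused the Move-up was answered incorrectly.  A Move-down that
-- leaves (or stays off) the path follows either an incorrect main answer or a
-- correct one; in the latter case all true answers between v and the node where
-- the path left L_x agree with it while the answer stored at that node does not,
-- so a checkup was asked and answered incorrectly.  Hence mu_end + dist u ≤ H, and
-- the (H - mu_end)-th ancestor of u contains L_x.  Independently, every iteration
-- raises depth + 2 mu by one using at most two queries, so
-- depth u + 2 mu_end ≥ ⌊n/2⌋, which gives the depth bound.

module Submission where

open import Defs
open import Data.Nat
open import Data.Nat.Properties
open import Data.Nat.Tactic.RingSolver using (solve-∀)
open import Data.Bool using (Bool; true; false; not) renaming (_≟_ to _≟ᵇ_)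
open import Data.Bool.Properties using (¬-not; not-¬; not-involutive)
open import Data.List using ([]; _∷_; _++_; length; drop)
open import Data.List.Properties using (≡-dec; length-++; ++-assoc; length-drop; drop-drop)
open import Data.Maybe using (just; nothing)
open import Data.Maybe.Properties using (just-injective)
open import Data.Product using (∃-syntax; _×_; _,_; proj₁)
open import Data.Sum using (_⊎_; inj₁; inj₂)
open import Data.Unit using (⊤; tt)
open import Relation.Nullary using (¬_; Dec; yes; no; contradiction)
open import Relation.Nullary.Decidable using (_×-dec_)
open import Relation.Nullary.Reflects using (Reflects; ofʸ; ofⁿ)
open import Relation.Binary.PropositionalEquality
open import Function using (_∘_)

module Intervals (n : ℕ) where

  private
    2^-split : ∀ d → d < n → 2 ^ (n ∸ d) ≡ 2 * 2 ^ (n ∸ suc d)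
    2^-split d d<n = cong (2 ^_) (+-∸-assoc 1 d<n)

    left-identity : ∀ o p → 2 * o * p + 1 ≡ o * (2 * p) + 1
    left-identity = solve-∀

    right-identity : ∀ o p → (2 * o + 1 + 1) * p ≡ (o + 1) * (2 * p)
    right-identity = solve-∀

    width-identity : ∀ o p → (o + 1) * p ≡ o * p + p
    width-identity = solve-∀

  leftLeaf-left : ∀ v → depth v < n → leftLeaf n (false ∷ v) ≡ leftLeaf n v
  leftLeaf-left v d<n rewrite 2^-split (depth v) d<n =
    left-identity (offset v) (2 ^ (n ∸ suc (depth v)))

  rightLeaf-right : ∀ v → depth v < n → rightLeaf n (true ∷ v) ≡ rightLeaf n v
  rightLeaf-right v d<n rewrite 2^-split (depth v) d<n =
    right-identity (offset v) (2 ^ (n ∸ suc (depth v)))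

  leftLeaf-right : ∀ v → leftLeaf n (true ∷ v) ≡ suc (qIdx n v)
  leftLeaf-right v = +-comm (qIdx n v) 1

  leftLeaf≤rightLeaf : ∀ v → leftLeaf n v ≤ rightLeaf n v
  leftLeaf≤rightLeaf v = begin
    offset v * p + 1  ≤⟨ +-monoʳ-≤ (offset v * p) (m^n>0 2 (n ∸ depth v)) ⟩
    offset v * p + p  ≡⟨ width-identity (offset v) p ⟨
    rightLeaf n v     ∎
    where
    open ≤-Reasoning
    p = 2 ^ (n ∸ depth v)

  leftLeaf≤qIdx : ∀ v → depth v < n → leftLeaf n v ≤ qIdx n v
  leftLeaf≤qIdx v d<n = begin
    leftLeaf n v            ≡⟨ leftLeaf-left v d<n ⟨
    leftLeaf n (false ∷ v)  ≤⟨ leftLeaf≤rightLeaf (false ∷ v) ⟩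
    qIdx n v                ∎
    where open ≤-Reasoning

  qIdx<rightLeaf : ∀ v → depth v < n → qIdx n v < rightLeaf n v
  qIdx<rightLeaf v d<n = begin-strict
    qIdx n v               <⟨ n<1+n (qIdx n v) ⟩
    suc (qIdx n v)         ≡⟨ leftLeaf-right v ⟨
    leftLeaf n (true ∷ v)  ≤⟨ leftLeaf≤rightLeaf (true ∷ v) ⟩
    rightLeaf n (true ∷ v) ≡⟨ rightLeaf-right v d<n ⟩
    rightLeaf n v          ∎
    where open ≤-Reasoning

  leftLeaf-child≤ : ∀ b v → leftLeaf n (b ∷ v) ≤ suc (qIdx n v)
  leftLeaf-child≤ false v = m≤n⇒m≤1+n (leftLeaf≤rightLeaf (false ∷ v))
  leftLeaf-child≤ true  v = ≤-reflexive (leftLeaf-right v)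

  qIdx≤rightLeaf-child : ∀ b v → qIdx n v ≤ rightLeaf n (b ∷ v)
  qIdx≤rightLeaf-child false v = ≤-refl
  qIdx≤rightLeaf-child true  v = begin
    qIdx n v               ≤⟨ n≤1+n (qIdx n v) ⟩
    suc (qIdx n v)         ≡⟨ leftLeaf-right v ⟨
    leftLeaf n (true ∷ v)  ≤⟨ leftLeaf≤rightLeaf (true ∷ v) ⟩
    rightLeaf n (true ∷ v) ∎
    where open ≤-Reasoning

module Subtree (n x : ℕ) where

  open Intervals n

  In : Node → Set
  In v = InSubtree n v x

  In-root : 1 ≤ x → x ≤ 2 ^ n → In []
  In-root 1≤x x≤2ⁿ = 1≤x , ≤-trans x≤2ⁿ (≤-reflexive (sym (+-identityʳ (2 ^ n))))

  In? : ∀ v → Dec (In v)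
  In? v = (leftLeaf n v ≤? x) ×-dec (x ≤? rightLeaf n v)

  truth : Node → Bool
  truth v = x ≤ᵇ qIdx n v

  private
    truth-reflects : ∀ v → Reflects (x ≤ qIdx n v) (truth v)
    truth-reflects v = ≤ᵇ-reflects-≤ x (qIdx n v)

  ≤⇒truth≡true : ∀ v → x ≤ qIdx n v → truth v ≡ true
  ≤⇒truth≡true v x≤q with truth v | truth-reflects v
  ... | true  | _       = refl
  ... | false | ofⁿ x≰q = contradiction x≤q x≰q

  >⇒truth≡false : ∀ v → qIdx n v < x → truth v ≡ false
  >⇒truth≡false v q<x with truth v | truth-reflects v
  ... | false | _       = refl
  ... | true  | ofʸ x≤q = contradiction x≤q (<⇒≱ q<x)

  truth≡true⇒≤ : ∀ v → truth v ≡ true → x ≤ qIdx n v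
  truth≡true⇒≤ v t with truth v | truth-reflects v
  truth≡true⇒≤ v refl | true | ofʸ x≤q = x≤q

  truth≡false⇒> : ∀ v → truth v ≡ false → qIdx n v < x
  truth≡false⇒> v t with truth v | truth-reflects v
  truth≡false⇒> v refl | false | ofⁿ x≰q = ≰⇒> x≰q

  In-∷⁺ : ∀ b v → depth v < n → In v → truth v ≡ not b → In (b ∷ v)
  In-∷⁺ false v d<n (l≤x , _) t =
    ≤-trans (≤-reflexive (leftLeaf-left v d<n)) l≤x , truth≡true⇒≤ v t
  In-∷⁺ true v d<n (_ , x≤r) t =
    ≤-trans (≤-reflexive (leftLeaf-right v)) (truth≡false⇒> v t) ,
    ≤-trans x≤r (≤-reflexive (sym (rightLeaf-right v d<n)))

  In-∷⁻ : ∀ b v → depth v < n → In (b ∷ v) → In v × truth v ≡ not b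
  In-∷⁻ false v d<n (l≤x , x≤q) =
    (≤-trans (≤-reflexive (sym (leftLeaf-left v d<n))) l≤x , ≤-trans x≤q (<⇒≤ (qIdx<rightLeaf v d<n))) ,
    ≤⇒truth≡true v x≤q
  In-∷⁻ true v d<n (l≤x , x≤r) =
    (≤-trans (leftLeaf≤qIdx v d<n) (<⇒≤ q<x) , ≤-trans x≤r (≤-reflexive (rightLeaf-right v d<n))) ,
    >⇒truth≡false v q<x
    where
    q<x : qIdx n v < x
    q<x = ≤-trans (≤-reflexive (sym (leftLeaf-right v))) l≤x

  In-parent : ∀ v → depth v ≤ n → In v → In (parent v)
  In-parent []      _   in-v = in-v
  In-parent (b ∷ v) d≤n in-v = proj₁ (In-∷⁻ b v d≤n in-v)

  In-drop : ∀ i v → depth v ≤ n → In v → In (drop i v)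
  In-drop zero    v       _   in-v = in-v
  In-drop (suc i) []      _   in-v = in-v
  In-drop (suc i) (b ∷ v) d≤n in-v = In-drop i v (<⇒≤ d≤n) (In-parent (b ∷ v) d≤n in-v)

  -- Outside the subtree of L_x the whole subtree of a node lies on one side of x,
  -- so its main query has the same true answer as its parent's.
  truth-∷-outside : ∀ b v → suc (depth v) < n → ¬ In (b ∷ v) → truth (b ∷ v) ≡ truth v
  truth-∷-outside b v d<n ∉ with leftLeaf n (b ∷ v) ≤? x
  ... | no l≰x = trans (≤⇒truth≡true (b ∷ v) (≤-trans (<⇒≤ x<l) (leftLeaf≤qIdx (b ∷ v) d<n)))
                       (sym (≤⇒truth≡true v (s≤s⁻¹ (≤-trans x<l (leftLeaf-child≤ b v)))))
    where x<l = ≰⇒> l≰x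
  ... | yes l≤x = trans (>⇒truth≡false (b ∷ v) (<-trans (qIdx<rightLeaf (b ∷ v) d<n) r<x))
                        (sym (>⇒truth≡false v (≤-<-trans (qIdx≤rightLeaf-child b v) r<x)))
    where r<x = ≰⇒> (λ x≤r → ∉ (l≤x , x≤r))

  In-child : ∀ a v → depth v < n → In v → truth v ≡ a → In (child a v)
  In-child true  v = In-∷⁺ false v
  In-child false v = In-∷⁺ true v

  dist : Node → ℕ
  dist [] = 0
  dist (b ∷ v) with In? (b ∷ v)
  ... | yes _ = 0
  ... | no  _ = suc (dist v)

  dist-In : ∀ v → In v → dist v ≡ 0
  dist-In []      _    = refl
  dist-In (b ∷ v) in-v with In? (b ∷ v)
  ... | yes _ = refl
  ... | no ∉  = contradiction in-v ∉

  dist-∉ : ∀ b v → ¬ In (b ∷ v) → dist (b ∷ v) ≡ suc (dist v)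
  dist-∉ b v ∉ with In? (b ∷ v)
  ... | yes in-v = contradiction in-v ∉
  ... | no  _    = refl

  dist-∷ : ∀ b v → dist (b ∷ v) ≤ suc (dist v)
  dist-∷ b v with In? (b ∷ v)
  ... | yes _ = z≤n
  ... | no  _ = ≤-refl

  dist-child : ∀ a v → dist (child a v) ≤ suc (dist v)
  dist-child true  = dist-∷ false
  dist-child false = dist-∷ true

  In-drop-dist : In [] → ∀ v → In (drop (dist v) v)
  In-drop-dist root []      = root
  In-drop-dist root (b ∷ v) with In? (b ∷ v)
  ... | yes in-v = in-v
  ... | no  _    = In-drop-dist root v

  In-drop-≥dist : In [] → ∀ j v → dist v ≤ j → depth v ≤ n → In (drop j v)
  In-drop-≥dist root j v d≤j depth≤n =
    subst In (trans (drop-drop (dist v) (j ∸ dist v) v) (cong (λ i → drop i v) (m+[n∸m]≡n d≤j)))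
      (In-drop (j ∸ dist v) (drop (dist v) v)
        (≤-trans (≤-reflexive (length-drop (dist v) v)) (≤-trans (m∸n≤m (depth v) (dist v)) depth≤n))
        (In-drop-dist root v))

-- b ∷ w is reached from w by the answer not b (see child).
Consistent : Store → Node → Set
Consistent sto []      = ⊤
Consistent sto (b ∷ w) = sto w ≡ just (not b) × Consistent sto w

update-≢ : ∀ sto v a w → w ≢ v → update sto v a w ≡ sto w
update-≢ sto v a w w≢v with ≡-dec _≟ᵇ_ w v
... | yes w≡v = contradiction w≡v w≢v
... | no  _   = refl

update-self : ∀ sto v a → update sto v a v ≡ just a
update-self sto v a with ≡-dec _≟ᵇ_ v v
... | yes _   = refl
... | no  v≢v = contradiction refl v≢v

Consistent-update : ∀ sto v a w → depth w ≤ depth v → Consistent sto w → Consistent (update sto v a) w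
Consistent-update sto v a []      _   _               = tt
Consistent-update sto v a (b ∷ w) w<v (sto-w , cons-w) =
  trans (update-≢ sto v a w (λ { refl → <-irrefl refl w<v })) sto-w ,
  Consistent-update sto v a w (<⇒≤ w<v) cons-w

Consistent-child : ∀ sto a v → Consistent sto v → sto v ≡ just a → Consistent sto (child a v)
Consistent-child sto true  v cons sto-v = sto-v , cons
Consistent-child sto false v cons sto-v = sto-v , cons

Consistent-parent : ∀ sto v → Consistent sto v → Consistent sto (parent v)
Consistent-parent sto []      _          = tt
Consistent-parent sto (b ∷ v) (_ , cons) = cons

findDiff-skip : ∀ sto w {a ws} → sto w ≡ just a → findDiff sto a (w ∷ ws) ≡ findDiff sto a ws
findDiff-skip sto w {true}  sto-w rewrite sto-w = refl
findDiff-skip sto w {false} sto-w rewrite sto-w = refl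

findDiff-hit : ∀ sto w {a ws} → sto w ≡ just (not a) → findDiff sto a (w ∷ ws) ≡ just w
findDiff-hit sto w {true}  sto-w rewrite sto-w = refl
findDiff-hit sto w {false} sto-w rewrite sto-w = refl

module Detection (n x : ℕ) where

  open Subtree n x

  -- On the path to L_x the stored answers of the ancestors are the true ones.
  on-track-ancestor : ∀ sto a v w → depth v ≤ n → Consistent sto v → In v →
                      findDiff sto a (ancestors v) ≡ just w → truth w ≡ not a
  on-track-ancestor sto a (b ∷ u) w d≤n (sto-u , cons-u) in-v found
    with In-∷⁻ b u d≤n in-v | b ≟ᵇ a
  ... | _ , truth-u | yes refl =
    trans (cong truth (just-injective (trans (sym found) (findDiff-hit sto u sto-u)))) truth-u
  ... | in-u , _ | no b≢a =
    on-track-ancestor sto a u w (<⇒≤ d≤n) cons-u in-u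
      (trans (sym (findDiff-skip sto u sto-u′)) found)
    where
    sto-u′ : sto u ≡ just a
    sto-u′ = trans sto-u (cong just (trans (cong not (¬-not b≢a)) (not-involutive a)))

  -- Off the path, all true answers between v and the node where the path left L_x
  -- coincide, while the answer stored at that node is the opposite one.
  stray-detected : In [] → ∀ sto v → depth v < n → Consistent sto v → ¬ In v →
                   ∃[ w ] findDiff sto (truth v) (ancestors v) ≡ just w × truth w ≡ truth v
  stray-detected root sto []      _   _                ∉ = contradiction root ∉
  stray-detected root sto (b ∷ u) d<n (sto-u , cons-u) ∉
    rewrite truth-∷-outside b u d<n ∉ with b ≟ᵇ truth u
  ... | yes refl = u , findDiff-hit sto u sto-u , refl
  ... | no b≢t   =
    let w , found , truth-w = stray-detected root sto u (<-trans (n<1+n _) d<n) cons-u ∉u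
    in  w , trans (findDiff-skip sto u sto-u′) found , truth-w
    where
    truth-u : truth u ≡ not b
    truth-u = trans (sym (not-involutive (truth u))) (cong not (sym (¬-not b≢t)))
    sto-u′ : sto u ≡ just (truth u)
    sto-u′ = trans sto-u (cong just (sym truth-u))
    ∉u : ¬ In u
    ∉u in-u = ∉ (In-∷⁺ b u (<-trans (n<1+n _) d<n) in-u truth-u)

module Errors (x : ℕ) where

  wrong-++ : ∀ h h′ → wrong x (h ++ h′) ≡ wrong x h + wrong x h′
  wrong-++ []            h′ = refl
  wrong-++ ((q , a) ∷ h) h′ =
    trans (cong (_ +_) (wrong-++ h h′)) (sym (+-assoc _ (wrong x h) (wrong x h′)))

  wrong-∷-incorrect : ∀ q a h → a ≢ (x ≤ᵇ q) → wrong x ((q , a) ∷ h) ≡ suc (wrong x h)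
  wrong-∷-incorrect q a h a≢t with a ≟ᵇ (x ≤ᵇ q)
  ... | yes a≡t = contradiction a≡t a≢t
  ... | no  _   = refl

  wrong-∷ : ∀ e h → wrong x h ≤ wrong x (e ∷ h)
  wrong-∷ (q , a) h = m≤n+m (wrong x h) _

entry : ℕ → Node → Bool → ℕ × Bool
entry n v a = (qIdx n v , a)

module Potential (n x : ℕ) (root : Subtree.In n x []) where

  open Subtree n x
  open Detection n x
  open Errors x

  main-wrong : ∀ v a h → a ≢ truth v → 1 ≤ wrong x (entry n v a ∷ h)
  main-wrong v a h a≢t = ≤-trans (s≤s z≤n) (≤-reflexive (sym (wrong-∷-incorrect (qIdx n v) a h a≢t)))

  check-wrong : ∀ e w c → c ≢ truth w → 1 ≤ wrong x (e ∷ entry n w c ∷ [])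
  check-wrong e w c c≢t = ≤-trans (main-wrong w c [] c≢t) (wrong-∷ e (entry n w c ∷ []))

  main-answer-cases : ∀ v a h →
                      1 ≤ wrong x (entry n v a ∷ h) ⊎ (In v × truth v ≡ a) ⊎ (¬ In v × truth v ≡ a)
  main-answer-cases v a h with truth v ≟ᵇ a | In? v
  ... | no  t≢a | _        = inj₁ (main-wrong v a h (t≢a ∘ sym))
  ... | yes t≡a | yes in-v = inj₂ (inj₁ (in-v , t≡a))
  ... | yes t≡a | no  ∉    = inj₂ (inj₂ (∉ , t≡a))

  dist-after-down : ∀ a v new → depth v < n → (In v × truth v ≡ a) ⊎ 1 ≤ wrong x new →
                    dist (child a v) ≤ dist v + wrong x new
  dist-after-down a v new d<n (inj₁ (in-v , t≡a)) =
    ≤-trans (≤-reflexive (dist-In (child a v) (In-child a v d<n in-v t≡a))) z≤n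
  dist-after-down a v new d<n (inj₂ error) = begin
    dist (child a v)     ≤⟨ dist-child a v ⟩
    suc (dist v)         ≡⟨ +-comm 1 (dist v) ⟩
    dist v + 1           ≤⟨ +-monoʳ-≤ (dist v) error ⟩
    dist v + wrong x new ∎
    where open ≤-Reasoning

  dist-after-down₁ : ∀ sto a v → depth v < n → Consistent sto v →
                     findDiff sto a (ancestors v) ≡ nothing →
                     dist (child a v) ≤ dist v + wrong x (entry n v a ∷ [])
  dist-after-down₁ sto a v d<n cons none with main-answer-cases v a []
  ... | inj₁ error         = dist-after-down a v (entry n v a ∷ []) d<n (inj₂ error)
  ... | inj₂ (inj₁ on)     = dist-after-down a v (entry n v a ∷ []) d<n (inj₁ on)
  ... | inj₂ (inj₂ (∉ , refl)) with stray-detected root sto v d<n cons ∉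
  ...   | _ , found , _ = contradiction (trans (sym none) found) λ ()

  dist-after-down₂ : ∀ sto a c v w → depth v < n → Consistent sto v →
                     findDiff sto a (ancestors v) ≡ just w → c ≡ not a →
                     dist (child a v) ≤ dist v + wrong x (entry n v a ∷ entry n w c ∷ [])
  dist-after-down₂ sto a c v w d<n cons found c≡ with main-answer-cases v a (entry n w c ∷ [])
  ... | inj₁ error         = dist-after-down a v (entry n v a ∷ entry n w c ∷ []) d<n (inj₂ error)
  ... | inj₂ (inj₁ on)     = dist-after-down a v (entry n v a ∷ entry n w c ∷ []) d<n (inj₁ on)
  ... | inj₂ (inj₂ (∉ , refl)) with stray-detected root sto v d<n cons ∉
  ...   | w′ , found′ , truth-w′ with just-injective (trans (sym found) found′)
  ...     | refl =
    dist-after-down a v (entry n v a ∷ entry n w c ∷ []) d<n (inj₂ (check-wrong (entry n v a) w c c≢t))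
    where
    c≢t : c ≢ truth w
    c≢t c≡t = not-¬ refl (trans (sym truth-w′) (trans (sym c≡t) c≡))

  dist-after-up : ∀ sto a c v w → depth v < n → Consistent sto v →
                  findDiff sto a (ancestors v) ≡ just w → c ≢ not a →
                  suc (dist (parent v)) ≤ dist v + wrong x (entry n v a ∷ entry n w c ∷ [])
  dist-after-up sto a c v w d<n cons found c≢ with In? v
  ... | yes in-v = begin
    suc (dist (parent v))    ≡⟨ cong suc (dist-In (parent v) (In-parent v (<⇒≤ d<n) in-v)) ⟩
    1                        ≤⟨ check-wrong (entry n v a) w c (λ c≡t → c≢ (trans c≡t truth-w)) ⟩
    wrong x queries          ≡⟨ cong (_+ wrong x queries) (dist-In v in-v) ⟨
    dist v + wrong x queries ∎
    where
    open ≤-Reasoning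
    queries = entry n v a ∷ entry n w c ∷ []
    truth-w = on-track-ancestor sto a v w (<⇒≤ d<n) cons in-v found
  ... | no ∉ with v
  ...   | []    = contradiction root ∉
  ...   | b ∷ u = ≤-trans (≤-reflexive (sym (dist-∉ b u ∉))) (m≤m+n _ _)

progress : State → ℕ
progress s = depth (node s) + 2 * mu s

record Invariant (n x k : ℕ) (s : State) : Set where
  field
    consistent        : Consistent (store s) (node s)
    potential         : mu s + Subtree.dist n x (node s) ≤ wrong x (hist s)
    budget            : length (hist s) + k ≡ n
    progress≤queries  : progress s ≤ length (hist s)
    queries≤2progress : length (hist s) ≤ progress s + progress s

Outcome : ℕ → ℕ → State → Set
Outcome n x s = mu s + Subtree.dist n x (node s) ≤ wrong x (hist s)
              × depth (node s) ≤ n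
              × n ≤ suc (progress s + progress s)

depth-child : ∀ a v → depth (child a v) ≡ suc (depth v)
depth-child true  v = refl
depth-child false v = refl

module Run (n x : ℕ) (root : Subtree.In n x []) (O : Oracle) where

  open Subtree n x using (dist)
  open Errors x
  open Potential n x root

  Invariant-initial : Invariant n x n initial
  Invariant-initial = record
    { consistent = tt ; potential = z≤n ; budget = refl
    ; progress≤queries = z≤n ; queries≤2progress = z≤n }

  Invariant-depth : ∀ {k v sto m h} → Invariant n x (suc k) (st v sto m h) → depth v < n
  Invariant-depth {k} {v} {m = m} {h} I = begin-strict
    depth v            ≤⟨ m≤m+n (depth v) (2 * m) ⟩
    depth v + 2 * m    ≤⟨ progress≤queries ⟩
    length h           <⟨ m<m+n (length h) (s≤s z≤n) ⟩
    length h + suc k   ≡⟨ budget ⟩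
    n                  ∎
    where
    open ≤-Reasoning
    open Invariant I

  advance : ∀ {k v sto m h} v′ sto′ m′ new → Invariant n x (length new + k) (st v sto m h) →
            1 ≤ length new → length new ≤ 2 →
            depth v′ + 2 * m′ ≡ suc (depth v + 2 * m) →
            m′ + dist v′ ≤ (m + dist v) + wrong x new →
            Consistent sto′ v′ →
            Invariant n x k (st v′ sto′ m′ (h ++ new))
  advance {k} {v} {m = m} {h} v′ sto′ m′ new I 1≤ℓ ℓ≤2 E′≡ pot cons = record
    { consistent        = cons
    ; potential         = begin
        m′ + dist v′                ≤⟨ pot ⟩
        (m + dist v) + wrong x new  ≤⟨ +-monoˡ-≤ (wrong x new) potential ⟩
        wrong x h + wrong x new     ≡⟨ wrong-++ h new ⟨
        wrong x (h ++ new)          ∎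
    ; budget            = begin-equality
        length (h ++ new) + k       ≡⟨ cong (_+ k) (length-++ h) ⟩
        length h + length new + k   ≡⟨ +-assoc (length h) (length new) k ⟩
        length h + (length new + k) ≡⟨ budget ⟩
        n                           ∎
    ; progress≤queries  = begin
        depth v′ + 2 * m′           ≡⟨ E′≡ ⟩
        suc E                       ≤⟨ s≤s progress≤queries ⟩
        suc (length h)              ≡⟨ +-comm 1 (length h) ⟩
        length h + 1                ≤⟨ +-monoʳ-≤ (length h) 1≤ℓ ⟩
        length h + length new       ≡⟨ length-++ h ⟨
        length (h ++ new)           ∎
    ; queries≤2progress = begin
        length (h ++ new)           ≡⟨ length-++ h ⟩
        length h + length new       ≤⟨ +-mono-≤ queries≤2progress ℓ≤2 ⟩
        (E + E) + 2                 ≡⟨ +-comm (E + E) 2 ⟩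
        suc (suc (E + E))           ≡⟨ cong suc (+-suc E E) ⟨
        suc E + suc E               ≡⟨ cong₂ _+_ E′≡ E′≡ ⟨
        (depth v′ + 2 * m′) + (depth v′ + 2 * m′) ∎
    }
    where
    open ≤-Reasoning
    open Invariant I
    E = depth v + 2 * m

  private
    +-assoc-monoʳ-≤ : ∀ m {d′ d w} → d′ ≤ d + w → m + d′ ≤ (m + d) + w
    +-assoc-monoʳ-≤ m {d′} {d} {w} le = ≤-trans (+-monoʳ-≤ m le) (≤-reflexive (sym (+-assoc m d w)))

    progress-up : ∀ d m → d + 2 * suc m ≡ suc (suc d + 2 * m)
    progress-up = solve-∀

  step-down₁ : ∀ {k v sto m h} a → Invariant n x (suc k) (st v sto m h) →
               findDiff (update sto v a) a (ancestors v) ≡ nothing →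
               Invariant n x k (st (child a v) (update sto v a) m (h ++ entry n v a ∷ []))
  step-down₁ {v = v} {sto} {m} a I none =
    advance (child a v) (update sto v a) m (entry n v a ∷ []) I ≤-refl (s≤s z≤n)
      (cong (_+ 2 * m) (depth-child a v))
      (+-assoc-monoʳ-≤ m (dist-after-down₁ (update sto v a) a v (Invariant-depth I) cons none))
      (Consistent-child (update sto v a) a v cons (update-self sto v a))
    where cons = Consistent-update sto v a v ≤-refl (Invariant.consistent I)

  step-down₂ : ∀ {k v sto m h} a w c → Invariant n x (suc (suc k)) (st v sto m h) →
               findDiff (update sto v a) a (ancestors v) ≡ just w → c ≡ not a →
               Invariant n x k (st (child a v) (update sto v a) m
                                   ((h ++ entry n v a ∷ []) ++ entry n w c ∷ []))
  step-down₂ {k} {v} {sto} {m} {h} a w c I found c≡ =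
    subst (λ h′ → Invariant n x k (st (child a v) (update sto v a) m h′)) (sym (++-assoc h _ _))
      (advance (child a v) (update sto v a) m queries I (s≤s z≤n) ≤-refl
        (cong (_+ 2 * m) (depth-child a v))
        (+-assoc-monoʳ-≤ m (dist-after-down₂ (update sto v a) a c v w (Invariant-depth I) cons found c≡))
        (Consistent-child (update sto v a) a v cons (update-self sto v a)))
    where
    cons = Consistent-update sto v a v ≤-refl (Invariant.consistent I)
    queries = entry n v a ∷ entry n w c ∷ []

  step-up : ∀ {k v sto m h} a w c → Invariant n x (suc (suc k)) (st v sto m h) →
            findDiff (update sto v a) a (ancestors v) ≡ just w → c ≢ not a →
            Invariant n x k (st (parent v) (update sto v a) (suc m)
                                ((h ++ entry n v a ∷ []) ++ entry n w c ∷ []))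
  step-up {k} {b ∷ u} {sto} {m} {h} a w c I found c≢ =
    subst (λ h′ → Invariant n x k (st u (update sto v a) (suc m) h′)) (sym (++-assoc h _ _))
      (advance u (update sto v a) (suc m) queries I (s≤s z≤n) ≤-refl
        (progress-up (depth u) m)
        (≤-trans (≤-reflexive (sym (+-suc m (dist u))))
                 (+-assoc-monoʳ-≤ m (dist-after-up (update sto v a) a c v w (Invariant-depth I) cons found c≢)))
        (Consistent-parent (update sto v a) v cons))
    where
    v = b ∷ u
    cons = Consistent-update sto v a v ≤-refl (Invariant.consistent I)
    queries = entry n v a ∷ entry n w c ∷ []

  finish : ∀ {s} → Invariant n x 0 s → Outcome n x s
  finish {s} I =
    potential ,
    ≤-trans (m≤m+n _ _) (≤-trans progress≤queries (≤-reflexive n≡L)) ,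
    ≤-trans (≤-reflexive (sym n≡L)) (m≤n⇒m≤1+n queries≤2progress)
    where
    open Invariant I
    n≡L : length (hist s) ≡ n
    n≡L = trans (sym (+-identityʳ _)) budget

  stop : ∀ {v sto m h} sto′ e → Invariant n x 1 (st v sto m h) →
         Outcome n x (st v sto′ m (h ++ e ∷ []))
  stop {v} {m = m} {h} sto′ e I =
    ≤-trans potential (≤-trans (m≤m+n _ _) (≤-reflexive (sym (wrong-++ h (e ∷ []))))) ,
    <⇒≤ (Invariant-depth I) ,
    (begin
      n                    ≡⟨ budget ⟨
      length h + 1         ≡⟨ +-comm (length h) 1 ⟩
      suc (length h)       ≤⟨ s≤s queries≤2progress ⟩
      suc (E + E)          ∎)
    where
    open ≤-Reasoning
    open Invariant I
    E = depth v + 2 * m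

  run-invariant : ∀ k s → Invariant n x k s → Outcome n x (run n O k s)
  run-invariant zero s I = finish I
  run-invariant (suc k) (st v sto m h) I with O h (qIdx n v)
  ... | a with findDiff (update sto v a) a (ancestors v) in found
  ...   | nothing = run-invariant k _ (step-down₁ a I found)
  ...   | just w with k
  ...     | zero = stop (update sto v a) (entry n v a) I
  ...     | suc k′ with O (h ++ entry n v a ∷ []) (qIdx n w)
  ...       | c with c ≟ᵇ not a
  ...         | yes c≡ = run-invariant k′ _ (step-down₂ a w c I found c≡)
  ...         | no  c≢ = run-invariant k′ _ (step-up a w c I found c≢)

depth≤depth-drop+ : ∀ j (v : Node) → depth v ≤ depth (drop j v) + j
depth≤depth-drop+ j v = begin
  depth v                  ≤⟨ m≤n+m∸n (depth v) j ⟩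
  j + (depth v ∸ j)        ≡⟨ +-comm j _ ⟩
  (depth v ∸ j) + j        ≡⟨ cong (_+ j) (length-drop j v) ⟨
  depth (drop j v) + j     ∎
  where open ≤-Reasoning

n≤1+m+m⇒⌊n/2⌋≤m : ∀ {n m} → n ≤ suc (m + m) → ⌊ n /2⌋ ≤ m
n≤1+m+m⇒⌊n/2⌋≤m {n} {m} n≤ = ≤-trans (⌊n/2⌋-mono n≤) (≤-reflexive (sym (n≡⌈n+n/2⌉ m)))

m≤n⇒n∸m+2*m≤2*n : ∀ {m n} → m ≤ n → (n ∸ m) + 2 * m ≤ 2 * n
m≤n⇒n∸m+2*m≤2*n {m} {n} m≤n = begin
  (n ∸ m) + 2 * m                ≤⟨ m≤m+n _ (n ∸ m) ⟩
  (n ∸ m) + 2 * m + (n ∸ m)      ≡⟨ identity (n ∸ m) m ⟩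
  2 * (m + (n ∸ m))              ≡⟨ cong (2 *_) (m+[n∸m]≡n m≤n) ⟩
  2 * n                          ∎
  where
  open ≤-Reasoning
  identity : ∀ d m → d + 2 * m + d ≡ 2 * (m + d)
  identity = solve-∀

ancestor-depth-bound : ∀ {n m H} (v : Node) → n ≤ suc ((depth v + 2 * m) + (depth v + 2 * m)) → m ≤ H →
                       ⌊ n /2⌋ ≤ depth (drop (H ∸ m) v) + 2 * H
ancestor-depth-bound {n} {m} {H} v n≤ m≤H = begin
  ⌊ n /2⌋                          ≤⟨ n≤1+m+m⇒⌊n/2⌋≤m n≤ ⟩
  depth v + 2 * m                  ≤⟨ +-monoˡ-≤ (2 * m) (depth≤depth-drop+ j v) ⟩
  depth (drop j v) + j + 2 * m     ≡⟨ +-assoc (depth (drop j v)) j (2 * m) ⟩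
  depth (drop j v) + (j + 2 * m)   ≤⟨ +-monoʳ-≤ (depth (drop j v)) (m≤n⇒n∸m+2*m≤2*n m≤H) ⟩
  depth (drop j v) + 2 * H         ∎
  where
  open ≤-Reasoning
  j = H ∸ m

lemma2 : (n H x : ℕ) (O : Oracle) → 1 ≤ n → 1 ≤ x → x ≤ 2 ^ n →
         wrong x (hist (rbis n O)) ≤ H →
         (⌊ n /2⌋ ≤ depth (finalNode n H O) + 2 * H)
         × InSubtree n (finalNode n H O) x
lemma2 n H x O _ 1≤x x≤2ⁿ wrong≤H
  with Run.run-invariant n x root O n initial (Run.Invariant-initial n x root O)
  where root = Subtree.In-root n x 1≤x x≤2ⁿ
... | potential , depth≤n , n≤ =
  ancestor-depth-bound v n≤ (m+n≤o⇒m≤o m m+dist≤H) ,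
  In-drop-≥dist (In-root 1≤x x≤2ⁿ) (H ∸ m) v dist≤H∸m depth≤n
  where
  open Subtree n x using (dist; In-root; In-drop-≥dist)
  v = node (rbis n O)
  m = mu (rbis n O)
  m+dist≤H : m + dist v ≤ H
  m+dist≤H = ≤-trans potential wrong≤H
  dist≤H∸m : dist v ≤ H ∸ m
  dist≤H∸m = m+n≤o⇒m≤o∸n (dist v) (≤-trans (≤-reflexive (+-comm (dist v) m)) m+dist≤H)
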